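{- For every positive integer $k$ and every integer $n\ge 3$, there exists a $(2kn)\times(2kn)$ matrix $S$ and $k+1$ pairwise non-isomorphic simple, undirected graphs $G_1,\dots,G_{k+1}$ (each on $2kn$ vertices) such that $A(G_i)^2=S$ for all $i=1,\dots,k+1$, where $A(G_i)$ is the adjacency matrix of $G_i$ with respect to a suitable ordering of its vertices.
   Context: The adjacency matrix $A(G)=(a_{ij})$ of a graph with ordered vertices $v_1,\dots,v_m$ has $a_{ij}=1$ if $v_iv_j$ is an edge and $0$ otherwise. -}

module Defs where

open import Data.Nat using (ℕ; zero; suc; _+_; _*_)
open import Data.Bool using (Bool; true; false; if_then_else_)
open import Data.Fin using (Fin; zero; suc)
open import Data.Fin.Permutation using (Permutation′; _⟨$⟩ʳ_)
open import Data.Product using (Σ)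
open import Relation.Binary.PropositionalEquality using (_≡_)

record SimpleGraph (m : ℕ) : Set where
  field
    Adj   : Fin m → Fin m → Bool
    sym   : ∀ i j → Adj i j ≡ Adj j i
    loopless : ∀ i → Adj i i ≡ false
open SimpleGraph public

Matrix : ℕ → Set
Matrix m = Fin m → Fin m → ℕ

adjMatrix : ∀ {m} → SimpleGraph m → Matrix m
adjMatrix G i j = if Adj G i j then 1 else 0

sumFin : ∀ {m} → (Fin m → ℕ) → ℕ
sumFin {zero}  f = 0
sumFin {suc m} f = f zero + sumFin (λ l → f (suc l))

_·_ : ∀ {m} → Matrix m → Matrix m → Matrix m
(A · B) i j = sumFin (λ l → A i l * B l j)

Isomorphic : ∀ {m} → SimpleGraph m → SimpleGraph m → Set
Isomorphic {m} G H =
  Σ (Permutation′ m) λ σ → ∀ i j → Adj H (σ ⟨$⟩ʳ i) (σ ⟨$⟩ʳ j) ≡ Adj G i j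

-- In G c each of the k blocks is either two disjoint copies of Kₙ or the bipartite double cover
-- Kₙ × K₂ of Kₙ, the first c blocks being of the second kind. G c arises from G 0 by swapping the
-- two sides of those blocks in the second argument of the adjacency relation, i.e. A(G c) = A(G 0) P
-- for a symmetric permutation matrix P, whence A(G c)² = A(G 0)². The graphs are told apart by the
-- number 2n(k − c) of vertices lying on a triangle: switched blocks are bipartite, while in the
-- others every vertex lies in a Kₙ with n ≥ 3.

module Submission where

open import Defs
open import Data.Nat using (ℕ; suc; _*_; _≤_)
open import Data.Fin using (Fin)
open import Data.Product using (Σ; _×_)
open import Relation.Binary.PropositionalEquality using (_≡_; _≢_)
open import Relation.Nullary using (¬_)

import Algebra.Properties.CommutativeMonoid.Sum as CommutativeMonoidSum
open import Data.Bool as Bool using (Bool; true; false; _xor_; if_then_else_)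
open import Data.Bool.Properties using (not-involutive; not-¬)
open import Data.Fin using (zero; suc; toℕ; fromℕ<)
open import Data.Fin.Properties as Fin using (any?; *↔×; 2↔Bool; toℕ<n; toℕ-fromℕ<; toℕ-injective)
open import Data.Fin.Permutation using (Permutation′; _⟨$⟩ʳ_; flip; inverseˡ; inverseʳ)
open import Data.Nat using (zero; _+_; _<_; z≤n; s≤s; _<?_)
open import Data.Nat.Properties
  using (+-0-commutativeMonoid; ≤-refl; ≤-trans; ≤-pred; <⇒≤; <-≤-trans; +-mono-≤; +-mono-<-≤; +-mono-≤-<;
         ≮⇒≥; ≤⇒≯; <⇒≱; <-cmp; <-irrefl)
open import Data.Product using (_,_; ∃₂; proj₁)
open import Data.Product.Function.NonDependent.Propositional using (_×-↔_)
open import Function using (_∘_)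
open import Function.Bundles using (_↔_; _⇔_; mk⇔; mk↔ₛ′; Inverse; Equivalence)
open import Function.Properties.Inverse using (↔-refl; ↔-sym; ↔-trans)
open import Relation.Binary.Definitions using (tri<; tri≈; tri>)
open import Relation.Binary.PropositionalEquality as ≡ using (refl; trans; cong; cong₂; subst; subst₂; module ≡-Reasoning)
open import Relation.Nullary using (Dec; yes; no; does; contradiction)
open import Relation.Nullary.Decidable using (_×-dec_; ¬?; dec-true; dec-false; does-≡; does-⇔)

private
  variable
    m : ℕ
    A B : Set

xor-involutiveˡ : ∀ b t → b xor (b xor t) ≡ t
xor-involutiveˡ false t = refl
xor-involutiveˡ true  t = not-involutive t

does≡true⇒ : (a? : Dec A) → does a? ≡ true → A
does≡true⇒ (yes a) _ = a
does≡true⇒ (no _) ()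

indicator : Dec A → ℕ
indicator a? = if does a? then 1 else 0

indicator-mono : (A → B) → (a? : Dec A) (b? : Dec B) → indicator a? ≤ indicator b?
indicator-mono _ (no _)  _       = z≤n
indicator-mono _ (yes _) (yes _) = ≤-refl
indicator-mono f (yes a) (no ¬b) = contradiction (f a) ¬b

indicator-< : ¬ A → B → (a? : Dec A) (b? : Dec B) → indicator a? < indicator b?
indicator-< ¬a _ (yes a) _       = contradiction a ¬a
indicator-< _  _ (no _)  (yes _) = s≤s z≤n
indicator-< _  b (no _)  (no ¬b) = contradiction b ¬b

module ℕ-Sum = CommutativeMonoidSum +-0-commutativeMonoid

sumFin≡sum : (f : Fin m → ℕ) → sumFin f ≡ ℕ-Sum.sum f
sumFin≡sum {zero}  f = refl
sumFin≡sum {suc m} f = cong (f zero +_) (sumFin≡sum (f ∘ suc))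

sumFin-cong : {f g : Fin m → ℕ} → (∀ i → f i ≡ g i) → sumFin f ≡ sumFin g
sumFin-cong {zero}  f≗g = refl
sumFin-cong {suc m} f≗g = cong₂ _+_ (f≗g zero) (sumFin-cong (f≗g ∘ suc))

sumFin-permute : (f : Fin m → ℕ) (π : Permutation′ m) → sumFin (f ∘ (π ⟨$⟩ʳ_)) ≡ sumFin f
sumFin-permute f π = begin
  sumFin (f ∘ (π ⟨$⟩ʳ_))     ≡⟨ sumFin≡sum (f ∘ (π ⟨$⟩ʳ_)) ⟩
  ℕ-Sum.sum (f ∘ (π ⟨$⟩ʳ_))  ≡⟨ ℕ-Sum.sum-permute f π ⟨
  ℕ-Sum.sum f                ≡⟨ sumFin≡sum f ⟨
  sumFin f                   ∎
  where open ≡-Reasoning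

sumFin-mono-≤ : {f g : Fin m → ℕ} → (∀ i → f i ≤ g i) → sumFin f ≤ sumFin g
sumFin-mono-≤ {zero}  f≤g = z≤n
sumFin-mono-≤ {suc m} f≤g = +-mono-≤ (f≤g zero) (sumFin-mono-≤ (f≤g ∘ suc))

sumFin-mono-< : {f g : Fin m → ℕ} → (∀ i → f i ≤ g i) → ∀ i → f i < g i → sumFin f < sumFin g
sumFin-mono-< f≤g zero    f<g = +-mono-<-≤ f<g (sumFin-mono-≤ (f≤g ∘ suc))
sumFin-mono-< f≤g (suc i) f<g = +-mono-≤-< (f≤g zero) (sumFin-mono-< (f≤g ∘ suc) i f<g)

-- Aᴴ = Aᴳ P for the permutation matrix P of σ, so Aᴴ² = Aᴴ (Aᴴ)ᵀ = Aᴳ P Pᵀ Aᴳ = Aᴳ².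
adjMatrix-square-switch : (G H : SimpleGraph m) (σ : Permutation′ m) →
  (∀ u w → Adj H u w ≡ Adj G u (σ ⟨$⟩ʳ w)) →
  ∀ a b → (adjMatrix H · adjMatrix H) a b ≡ (adjMatrix G · adjMatrix G) a b
adjMatrix-square-switch G H σ switch a b = begin
  sumFin (λ l → adjMatrix H a l * adjMatrix H l b)
    ≡⟨ sumFin-cong (λ l → cong₂ _*_ (cong bit (switch a l)) (cong bit (switch′ l b))) ⟩
  sumFin (λ l → adjMatrix G a (σ ⟨$⟩ʳ l) * adjMatrix G (σ ⟨$⟩ʳ l) b)
    ≡⟨ sumFin-permute (λ l → adjMatrix G a l * adjMatrix G l b) σ ⟩
  sumFin (λ l → adjMatrix G a l * adjMatrix G l b)
    ∎
  where
  open ≡-Reasoning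
  bit : Bool → ℕ
  bit x = if x then 1 else 0
  switch′ : ∀ u w → Adj H u w ≡ Adj G (σ ⟨$⟩ʳ u) w
  switch′ u w = trans (sym H u w) (trans (switch w u) (sym G w _))

Triangle : SimpleGraph m → Fin m → Fin m → Fin m → Set
Triangle G u v w = Adj G u v ≡ true × Adj G v w ≡ true × Adj G w u ≡ true

OnTriangle : SimpleGraph m → Fin m → Set
OnTriangle G u = ∃₂ (Triangle G u)

onTriangle? : (G : SimpleGraph m) (u : Fin m) → Dec (OnTriangle G u)
onTriangle? G u = any? λ v → any? λ w →
  (Adj G u v Bool.≟ true) ×-dec (Adj G v w Bool.≟ true) ×-dec (Adj G w u Bool.≟ true)

triangleVertexCount : SimpleGraph m → ℕ
triangleVertexCount G = sumFin λ u → indicator (onTriangle? G u)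

triangleVertexCount-< : (G H : SimpleGraph m) → (∀ u → OnTriangle G u → OnTriangle H u) →
  ∀ u → ¬ OnTriangle G u → OnTriangle H u → triangleVertexCount G < triangleVertexCount H
triangleVertexCount-< G H G⊆H u ¬Gu Hu =
  sumFin-mono-< (λ v → indicator-mono (G⊆H v) (onTriangle? G v) (onTriangle? H v))
                u (indicator-< ¬Gu Hu (onTriangle? G u) (onTriangle? H u))

Isomorphic-sym : (G H : SimpleGraph m) → Isomorphic G H → Isomorphic H G
Isomorphic-sym G H (σ , σ-adj) =
  flip σ , λ i j → trans (≡.sym (σ-adj (flip σ ⟨$⟩ʳ i) (flip σ ⟨$⟩ʳ j)))
                         (cong₂ (Adj H) (inverseʳ σ) (inverseʳ σ))

onTriangle-transport : (G H : SimpleGraph m) (iso : Isomorphic G H) {u : Fin m} →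
  OnTriangle G u → OnTriangle H (proj₁ iso ⟨$⟩ʳ u)
onTriangle-transport G H (σ , σ-adj) (v , w , uv , vw , wu) =
  σ ⟨$⟩ʳ v , σ ⟨$⟩ʳ w , trans (σ-adj _ v) uv , trans (σ-adj v w) vw , trans (σ-adj w _) wu

onTriangle-iso : (G H : SimpleGraph m) (iso : Isomorphic G H) (u : Fin m) →
  OnTriangle G u ⇔ OnTriangle H (proj₁ iso ⟨$⟩ʳ u)
onTriangle-iso G H iso@(σ , _) u = mk⇔ (onTriangle-transport G H iso)
  (subst (OnTriangle G) (inverseˡ σ) ∘ onTriangle-transport H G (Isomorphic-sym G H iso))

triangleVertexCount-iso : (G H : SimpleGraph m) → Isomorphic G H →
  triangleVertexCount G ≡ triangleVertexCount H
triangleVertexCount-iso G H iso@(σ , _) = begin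
  sumFin (λ u → indicator (onTriangle? G u))
    ≡⟨ sumFin-cong (λ u → cong (if_then 1 else 0)
         (does-⇔ (onTriangle-iso G H iso u) (onTriangle? G u) (onTriangle? H (σ ⟨$⟩ʳ u)))) ⟩
  sumFin (λ u → indicator (onTriangle? H (σ ⟨$⟩ʳ u)))
    ≡⟨ sumFin-permute (λ u → indicator (onTriangle? H u)) σ ⟩
  sumFin (λ u → indicator (onTriangle? H u))
    ∎
  where open ≡-Reasoning

module InducedGraph {V : Set} (encoding : Fin m ↔ V) (R : V → V → Set) (R? : ∀ x y → Dec (R x y))
                    (R-sym : ∀ {x y} → R x y → R y x) (R-irrefl : ∀ {x} → ¬ R x x) where

  open Inverse encoding using (to; from; strictlyInverseˡ; strictlyInverseʳ)

  graph : SimpleGraph m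
  graph = record
    { Adj      = λ u w → does (R? (to u) (to w))
    ; sym      = λ u w → does-⇔ (mk⇔ R-sym R-sym) (R? (to u) (to w)) (R? (to w) (to u))
    ; loopless = λ u → dec-false (R? (to u) (to u)) R-irrefl
    }

  from-adjacent : ∀ {x y} → R x y → Adj graph (from x) (from y) ≡ true
  from-adjacent {x} {y} r = dec-true (R? (to (from x)) (to (from y)))
    (subst₂ R (≡.sym (strictlyInverseˡ x)) (≡.sym (strictlyInverseˡ y)) r)

  onTriangle⇔ : ∀ u → OnTriangle graph u ⇔ ∃₂ λ y z → R (to u) y × R y z × R z (to u)
  onTriangle⇔ u = mk⇔
    (λ (v , w , uv , vw , wu) →
      to v , to w , does≡true⇒ (R? _ _) uv , does≡true⇒ (R? _ _) vw , does≡true⇒ (R? _ _) wu)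
    (λ (y , z , r₁ , r₂ , r₃) → subst (OnTriangle graph) (strictlyInverseʳ u)
      (from y , from z , from-adjacent r₁ , from-adjacent r₂ , from-adjacent r₃))

odd-cycle-parity : ∀ b s t r → s ≡ b xor t → t ≡ b xor r → r ≡ b xor s → b ≡ false
odd-cycle-parity false _ _ _ _  _  _  = refl
odd-cycle-parity true  s t r st tr rs =
  contradiction (trans st (trans (cong Bool.not tr) (trans (not-involutive r) rs))) (not-¬ refl)

twoOthers : 3 ≤ m → (x : Fin m) → ∃₂ λ y z → x ≢ y × y ≢ z × z ≢ x
twoOthers (s≤s (s≤s (s≤s _))) zero          = suc zero , suc (suc zero) , (λ ()) , (λ ()) , (λ ())
twoOthers (s≤s (s≤s (s≤s _))) (suc zero)    = zero , suc (suc zero) , (λ ()) , (λ ()) , (λ ())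
twoOthers (s≤s (s≤s (s≤s _))) (suc (suc _)) = zero , suc zero , (λ ()) , (λ ()) , (λ ())

-- A vertex is ((side , block) , index); block b of G c is switched iff b < c.
module Construction (k n : ℕ) where

  Vertex : Set
  Vertex = (Bool × Fin k) × Fin n

  block : Vertex → Fin k
  block ((_ , b) , _) = b

  switched : Fin (suc k) → Fin k → Bool
  switched c b = does (toℕ b <? toℕ c)

  Adjacent : Fin (suc k) → Vertex → Vertex → Set
  Adjacent c ((s , b) , x) ((t , b′) , y) = b ≡ b′ × x ≢ y × s ≡ switched c b′ xor t

  adjacent? : ∀ c u w → Dec (Adjacent c u w)
  adjacent? c ((s , b) , x) ((t , b′) , y) =
    b Fin.≟ b′ ×-dec ¬? (x Fin.≟ y) ×-dec s Bool.≟ switched c b′ xor t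

  Adjacent-sym : ∀ {c u w} → Adjacent c u w → Adjacent c w u
  Adjacent-sym {c} {(s , b) , _} {(t , _) , _} (refl , x≢y , s≡) =
    refl , x≢y ∘ ≡.sym ,
    trans (≡.sym (xor-involutiveˡ (switched c b) t)) (cong (switched c b xor_) (≡.sym s≡))

  Adjacent-irrefl : ∀ {c u} → ¬ Adjacent c u u
  Adjacent-irrefl (_ , x≢x , _) = x≢x refl

  switch : Fin (suc k) → Vertex → Vertex
  switch c ((t , b) , y) = (switched c b xor t , b) , y

  switch-involutive : ∀ c v → switch c (switch c v) ≡ v
  switch-involutive c ((t , b) , y) = cong (λ t′ → (t′ , b) , y) (xor-involutiveˡ (switched c b) t)

  encoding : Fin (2 * k * n) ↔ Vertex
  encoding = ↔-trans *↔× (↔-trans *↔× (2↔Bool ×-↔ ↔-refl) ×-↔ ↔-refl)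

  open Inverse encoding using (to; from; strictlyInverseˡ)

  module Induced (c : Fin (suc k)) =
    InducedGraph encoding (Adjacent c) (adjacent? c) (Adjacent-sym {c}) (Adjacent-irrefl {c})

  G : Fin (suc k) → SimpleGraph (2 * k * n)
  G = Induced.graph

  switching : Fin (suc k) → Permutation′ (2 * k * n)
  switching c = ↔-trans encoding (↔-trans involution (↔-sym encoding))
    where involution = mk↔ₛ′ (switch c) (switch c) (switch-involutive c) (switch-involutive c)

  -- Adjacent c u w and Adjacent zero u (switch c w) are the same type.
  Adj-switching : ∀ c u w → Adj (G c) u w ≡ Adj (G zero) u (switching c ⟨$⟩ʳ w)
  Adj-switching c u w =
    trans (does-≡ (adjacent? c (to u) (to w)) (adjacent? zero (to u) (switch c (to w))))
          (cong (does ∘ adjacent? zero (to u)) (≡.sym (strictlyInverseˡ (switch c (to w)))))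

  triangle⇒unswitched : ∀ {c u v w} → Adjacent c u v → Adjacent c v w → Adjacent c w u →
    switched c (block u) ≡ false
  triangle⇒unswitched {c} {(s , b) , _} {(t , _) , _} {(r , _) , _}
                      (refl , _ , st) (refl , _ , tr) (refl , _ , rs) =
    odd-cycle-parity (switched c b) s t r st tr rs

  unswitched⇒triangle : 3 ≤ n → ∀ c v → switched c (block v) ≡ false →
    ∃₂ λ y z → Adjacent c v y × Adjacent c y z × Adjacent c z v
  unswitched⇒triangle 3≤n c ((s , b) , x) unswitched with twoOthers 3≤n x
  ... | y , z , x≢y , y≢z , z≢x =
    ((s , b) , y) , ((s , b) , z) , sameSide x≢y , sameSide y≢z , sameSide z≢x
    where
    sameSide : ∀ {x y} → x ≢ y → Adjacent c ((s , b) , x) ((s , b) , y)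
    sameSide x≢y = refl , x≢y , ≡.sym (cong (_xor s) unswitched)

  unswitched⇔ : ∀ c b → switched c b ≡ false ⇔ toℕ c ≤ toℕ b
  unswitched⇔ c b = mk⇔
    (λ eq → ≮⇒≥ λ b<c → contradiction (trans (≡.sym (dec-true (toℕ b <? toℕ c) b<c)) eq) λ ())
    (λ c≤b → dec-false (toℕ b <? toℕ c) (≤⇒≯ c≤b))

  onTriangle⇔ : 3 ≤ n → ∀ c u → OnTriangle (G c) u ⇔ toℕ c ≤ toℕ (block (to u))
  onTriangle⇔ 3≤n c u = mk⇔
    (λ t → let (_ , _ , uv , vw , wu) = Equivalence.to (Induced.onTriangle⇔ c u) t
           in Equivalence.to (unswitched⇔ c _) (triangle⇒unswitched {c} uv vw wu))
    (λ c≤b → Equivalence.from (Induced.onTriangle⇔ c u)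
      (unswitched⇒triangle 3≤n c (to u) (Equivalence.from (unswitched⇔ c _) c≤b)))

  triangleVertexCount-decreasing : 3 ≤ n → ∀ {c d} → toℕ c < toℕ d →
    triangleVertexCount (G d) < triangleVertexCount (G c)
  triangleVertexCount-decreasing 3≤n {c} {d} c<d =
    triangleVertexCount-< (G d) (G c) Gd⊆Gc u₀
      (λ t → <⇒≱ c<d (subst (toℕ d ≤_) block-u₀ (onTriangle⇒ d u₀ t)))
      (onTriangle⇐ c u₀ (subst (toℕ c ≤_) (≡.sym block-u₀) ≤-refl))
    where
    onTriangle⇒ : ∀ e u → OnTriangle (G e) u → toℕ e ≤ toℕ (block (to u))
    onTriangle⇒ e u = Equivalence.to (onTriangle⇔ 3≤n e u)
    onTriangle⇐ : ∀ e u → toℕ e ≤ toℕ (block (to u)) → OnTriangle (G e) u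
    onTriangle⇐ e u = Equivalence.from (onTriangle⇔ 3≤n e u)
    Gd⊆Gc : ∀ u → OnTriangle (G d) u → OnTriangle (G c) u
    Gd⊆Gc u t = onTriangle⇐ c u (≤-trans (<⇒≤ c<d) (onTriangle⇒ d u t))
    x₀ : Fin n
    x₀ = fromℕ< (≤-trans (s≤s z≤n) 3≤n)
    c<k : toℕ c < k
    c<k = <-≤-trans c<d (≤-pred (toℕ<n d))
    u₀ : Fin (2 * k * n)
    u₀ = from ((false , fromℕ< c<k) , x₀)
    block-u₀ : toℕ (block (to u₀)) ≡ toℕ c
    block-u₀ = trans (cong (toℕ ∘ block) (strictlyInverseˡ ((false , fromℕ< c<k) , x₀)))
                     (toℕ-fromℕ< c<k)

mainTheorem7 : (k n : ℕ) → 1 ≤ k → 3 ≤ n →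
    Σ (Matrix (2 * k * n)) λ S →
    Σ (Fin (suc k) → SimpleGraph (2 * k * n)) λ G →
    (∀ i j → i ≢ j → ¬ Isomorphic (G i) (G j)) ×
    (∀ i → ∀ a b → (adjMatrix (G i) · adjMatrix (G i)) a b ≡ S a b)
mainTheorem7 k n _ 3≤n = adjMatrix (G zero) · adjMatrix (G zero) , G , nonIsomorphic , sameSquare
  where
  open Construction k n
  sameSquare : ∀ i a b →
    (adjMatrix (G i) · adjMatrix (G i)) a b ≡ (adjMatrix (G zero) · adjMatrix (G zero)) a b
  sameSquare i = adjMatrix-square-switch (G zero) (G i) (switching i) (Adj-switching i)
  nonIsomorphic : ∀ i j → i ≢ j → ¬ Isomorphic (G i) (G j)
  nonIsomorphic i j i≢j iso with <-cmp (toℕ i) (toℕ j)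
  ... | tri< i<j _ _ =
    <-irrefl (≡.sym (triangleVertexCount-iso (G i) (G j) iso)) (triangleVertexCount-decreasing 3≤n i<j)
  ... | tri≈ _ i≡j _ = i≢j (toℕ-injective i≡j)
  ... | tri> _ _ j<i =
    <-irrefl (triangleVertexCount-iso (G i) (G j) iso) (triangleVertexCount-decreasing 3≤n j<i)
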